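{- In every total partial combinatory algebra $\mathcal{A}$ (i.e. one in which $ab$ is defined for all $a,b\in\mathcal{A}$), $\bar 0$ and $\bar 1$ are not separable.
   Context: A pca $\mathcal{A}$ is a set with a partial, left-associative, strict application that is combinatory complete; equivalently it has $k,s$ with $kab=a$, $sab\downarrow$, $sabc\simeq ac(bc)$. With combinatory abstraction $\lambda^*$, put $i=skk$, $\mathsf{false}=ki$, $\langle a,b\rangle=\lambda^*z.zab$, numerals $\bar 0=i$, $\bar 1=\langle\mathsf{false},\bar 0\rangle$. $\bar 0,\bar 1$ are separable in $\mathcal{A}$ if there is $c\in\mathcal{A}$ with $ca$ defined and in $\{\bar 0,\bar 1\}$ for all $a$, such that $ca=\bar 0\Rightarrow a\ne\bar 1$ and $ca=\bar 1\Rightarrow a\ne\bar 0$. -}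

module Defs where

open import Level using (Level; suc)
open import Data.Nat using (ℕ; _≟_)
open import Data.Maybe using (Maybe; just; nothing; _>>=_)
open import Data.Product using (Σ; ∃; _×_; _,_)
open import Data.Sum using (_⊎_)
open import Relation.Nullary using (¬_; yes; no)
open import Relation.Binary.PropositionalEquality using (_≡_; _≢_)

_⊙[_]_ : ∀ {a} {A : Set a} → Maybe A → (A → A → Maybe A) → Maybe A → Maybe A
m ⊙[ app ] n = m >>= λ x → n >>= λ y → app x y

-- A partial combinatory algebra: partial application  _·_ : A → A → Maybe A
-- (nothing = undefined), with k and s satisfying
--   k a b = a,   s a b ↓,   s a b c ≃ a c (b c)   (≃ is ≡ on Maybe A).
record PCA (ℓ : Level) : Set (suc ℓ) where
  infixl 7 _·_
  field
    Carrier : Set ℓ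
    _·_     : Carrier → Carrier → Maybe Carrier
    k s     : Carrier

  infixl 7 _⊙_
  _⊙_ : Maybe Carrier → Maybe Carrier → Maybe Carrier
  m ⊙ n = m ⊙[ _·_ ] n

  field
    k-ax  : ∀ a b → just k ⊙ just a ⊙ just b ≡ just a
    s-def : ∀ a b → ∃ λ d → just s ⊙ just a ⊙ just b ≡ just d
    s-ax  : ∀ a b c → just s ⊙ just a ⊙ just b ⊙ just c
                      ≡ (just a ⊙ just c) ⊙ (just b ⊙ just c)

  data Term : Set ℓ where
    var : ℕ → Term
    con : Carrier → Term
    _∙_ : Term → Term → Term

  K S : Term
  K = con k
  S = con s

  I : Term
  I = (S ∙ K) ∙ K

  λ* : ℕ → Term → Term
  λ* x (var y) with x ≟ y
  ... | yes _ = I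
  ... | no  _ = K ∙ var y
  λ* x (con c) = K ∙ con c
  λ* x (t ∙ u) = (S ∙ λ* x t) ∙ λ* x u

  ⟦_⟧ : Term → Maybe Carrier
  ⟦ var _ ⟧ = nothing
  ⟦ con c ⟧ = just c
  ⟦ t ∙ u ⟧ = ⟦ t ⟧ ⊙ ⟦ u ⟧

  pairT : Term → Term → Term
  pairT a b = λ* 0 ((var 0 ∙ a) ∙ b)

  falseT : Term
  falseT = K ∙ I

  zeroT oneT : Term
  zeroT = I
  oneT  = pairT falseT zeroT

  0̄ 1̄ : Maybe Carrier
  0̄ = ⟦ zeroT ⟧
  1̄ = ⟦ oneT ⟧

  Total : Set ℓ
  Total = ∀ a b → ∃ λ d → a · b ≡ just d

  Separable : Set ℓ
  Separable = Σ Carrier λ c → ∀ a →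
      (c · a ≡ 0̄ ⊎ c · a ≡ 1̄)
    × (c · a ≡ 0̄ → just a ≢ 1̄)
    × (c · a ≡ 1̄ → just a ≢ 0̄)

module Submission where

-- Totality turns the partial application into a total binary operation _•_,
-- and the axioms for k and s become plain equations.  Evaluating terms under
-- an environment, combinatory abstraction satisfies the β-law
--   ⟦ λ* x . t ⟧ρ • p  =  ⟦ t ⟧ρ[x ≔ p],
-- from which we read off the behaviour of the numerals
-- (0̄ = i with i • p = p, and 1̄ = one with one • p = p • false • i)
-- and Curry's fixed point theorem: every f has an a with a = f • a.
--
-- Given a separator c, take a fixed point a = c • a • 1̄.  If c • a = 0̄ then
-- a = i • 1̄ = 1̄, and if c • a = 1̄ then a = 1̄ • 1̄ = 0̄; either way c
-- answers wrongly on a.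

open import Defs
open import Level using (Level)
open import Relation.Nullary using (¬_; yes; no)
open import Data.Nat using (ℕ; _≟_)
open import Data.Product using (∃; _×_; _,_; proj₁; proj₂)
open import Data.Sum using (inj₁; inj₂)
open import Data.Unit using (⊤)
open import Data.Empty using (⊥)
open import Data.Maybe using (just)
open import Data.Maybe.Properties using (just-injective)
open import Relation.Binary.PropositionalEquality
open ≡-Reasoning

module TotalPCA {ℓ : Level} (𝒜 : PCA ℓ) (total : PCA.Total 𝒜) where
  open PCA 𝒜

  infixl 7 _•_
  _•_ : Carrier → Carrier → Carrier
  a • b = proj₁ (total a b)

  ·-defined : ∀ a b → a · b ≡ just (a • b)
  ·-defined a b = proj₂ (total a b)

  •-from-· : ∀ {a b x} → a · b ≡ just x → a • b ≡ x
  •-from-· {a} {b} e = just-injective (trans (sym (·-defined a b)) e)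

  k-law : ∀ a b → k • a • b ≡ a
  k-law a b with k-ax a b
  ... | e rewrite ·-defined k a | ·-defined (k • a) b = just-injective e

  s-law : ∀ a b c → s • a • b • c ≡ (a • c) • (b • c)
  s-law a b c with s-ax a b c
  ... | e rewrite ·-defined s a | ·-defined (s • a) b | ·-defined (s • a • b) c
                | ·-defined a c | ·-defined b c | ·-defined (a • c) (b • c)
                = just-injective e

  i : Carrier
  i = s • k • k

  i-law : ∀ a → i • a ≡ a
  i-law a = trans (s-law k k a) (k-law a (k • a))

  Env : Set ℓ
  Env = ℕ → Carrier

  eval : Env → Term → Carrier
  eval ρ (var x) = ρ x
  eval ρ (con c) = c
  eval ρ (t ∙ u) = eval ρ t • eval ρ u

  _[_≔_] : Env → ℕ → Carrier → Env
  (ρ [ x ≔ p ]) y with x ≟ y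
  ... | yes _ = p
  ... | no  _ = ρ y

  β : ∀ ρ x t p → eval ρ (λ* x t) • p ≡ eval (ρ [ x ≔ p ]) t
  β ρ x (var y) p with x ≟ y
  ... | yes _ = i-law p
  ... | no  _ = k-law (ρ y) p
  β ρ x (con c) p = k-law c p
  β ρ x (t ∙ u) p = begin
      s • eval ρ (λ* x t) • eval ρ (λ* x u) • p
    ≡⟨ s-law _ _ p ⟩
      (eval ρ (λ* x t) • p) • (eval ρ (λ* x u) • p)
    ≡⟨ cong₂ _•_ (β ρ x t p) (β ρ x u p) ⟩
      eval (ρ [ x ≔ p ]) t • eval (ρ [ x ≔ p ]) u ∎

  Closed : Term → Set
  Closed (var _) = ⊥
  Closed (con _) = ⊤
  Closed (t ∙ u) = Closed t × Closed u

  ⟦⟧-closed : ∀ t → Closed t → ∀ ρ → ⟦ t ⟧ ≡ just (eval ρ t)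
  ⟦⟧-closed (con c) _ ρ = refl
  ⟦⟧-closed (t ∙ u) (ct , cu) ρ
    rewrite ⟦⟧-closed t ct ρ | ⟦⟧-closed u cu ρ = ·-defined (eval ρ t) (eval ρ u)

  -- Any environment will do for closed terms; we fix one.
  ρ₀ : Env
  ρ₀ _ = k

  -- Every element has a fixed point (Curry's Y: a = d • d with d • p = f • (p • p)).
  fixed-point : ∀ f → ∃ λ a → a ≡ f • a
  fixed-point f = d • d , β ρ₀ 0 (con f ∙ (var 0 ∙ var 0)) d
    where
    d : Carrier
    d = eval ρ₀ (λ* 0 (con f ∙ (var 0 ∙ var 0)))

  false one : Carrier
  false = k • i
  one   = eval ρ₀ oneT

  0̄-value : 0̄ ≡ just i
  0̄-value = ⟦⟧-closed zeroT _ ρ₀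

  1̄-value : 1̄ ≡ just one
  1̄-value = ⟦⟧-closed oneT _ ρ₀

  one-law : ∀ p → one • p ≡ p • false • i
  one-law p = β ρ₀ 0 ((var 0 ∙ falseT) ∙ zeroT) p

  one-one : one • one ≡ i
  one-one = begin
      one • one
    ≡⟨ one-law one ⟩
      one • false • i
    ≡⟨ cong (_• i) (one-law false) ⟩
      k • i • false • i • i
    ≡⟨ cong (λ z → z • i • i) (k-law i false) ⟩
      i • i • i
    ≡⟨ cong (_• i) (i-law i) ⟩
      i • i
    ≡⟨ i-law i ⟩
      i ∎

  self-referent : ∀ c → ∃ λ a → a ≡ c • a • one
  self-referent c with fixed-point (eval ρ₀ (λ* 0 ((con c ∙ var 0) ∙ con one)))
  ... | a , a-fixed = a , trans a-fixed (β ρ₀ 0 ((con c ∙ var 0) ∙ con one) a)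

  not-separable : ¬ Separable
  not-separable (c , separates) with self-referent c
  ... | a , a-fixed with separates a
  ...   | inj₁ ca≡0̄ , says-0 , _ = says-0 ca≡0̄ (trans (cong just a≡one) (sym 1̄-value))
    where
    a≡one : a ≡ one
    a≡one = begin
        a                ≡⟨ a-fixed ⟩
        c • a • one      ≡⟨ cong (_• one) (•-from-· (trans ca≡0̄ 0̄-value)) ⟩
        i • one          ≡⟨ i-law one ⟩
        one ∎
  ...   | inj₂ ca≡1̄ , _ , says-1 = says-1 ca≡1̄ (trans (cong just a≡i) (sym 0̄-value))
    where
    a≡i : a ≡ i
    a≡i = begin
        a                ≡⟨ a-fixed ⟩
        c • a • one      ≡⟨ cong (_• one) (•-from-· (trans ca≡1̄ 1̄-value)) ⟩
        one • one        ≡⟨ one-one ⟩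
        i ∎

corollary8p4 : ∀ {ℓ : Level} (𝒜 : PCA ℓ) → PCA.Total 𝒜 → ¬ PCA.Separable 𝒜
corollary8p4 𝒜 total = TotalPCA.not-separable 𝒜 total
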